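{- Let $\ell\ge1$, $0\le k\le\ell$, $B=(b_1,\dots,b_\ell)$ with integers $b_i\ge2$. Then $\mathrm{rank}(A_{\ell,k;B}A_{\ell,k;B}^{\top})=R_k(B)$ and $\mathrm{rank}(A_{\ell,k;B})=R_k(B)$, where $R_k(B)=\sum_{j=0}^{k}S_j(b_1-1,\dots,b_\ell-1)$.
   Context: For an integer $b\ge2$ let $\Sigma_b=\{0,\dots,b-1\}$ and $\Delta_b=\Sigma_b\cup\{g\}$, $g$ a gap symbol; $\Sigma_B=\prod_i\Sigma_{b_i}$, $\Delta_B=\prod_i\Delta_{b_i}$, elements written as words. $V_{\ell,k;B}$ is the set of $v\in\Delta_B$ with exactly $\ell-k$ coordinates equal to $g$. $u\in\Sigma_B$ and $v\in\Delta_B$ are matchable if $u_i=v_i$ whenever $v_i\ne g$. $A_{\ell,k;B}$ is the $(0,1)$-matrix with rows indexed by $V_{\ell,k;B}$, columns by $\Sigma_B$, with entry $1$ iff the indices are matchable. $S_j$ denotes the $j$-th elementary symmetric polynomial ($S_0=1$, $S_j=0$ for $j$ larger than the number of variables). -}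

module Defs where

open import Data.Nat as ℕ using (ℕ; zero; suc; _∸_)
open import Data.Fin using (Fin; zero; suc)
import Data.Fin.Properties as FinP
open import Data.Maybe using (Maybe; just; nothing)
open import Data.Bool using (Bool; true; false; if_then_else_)
open import Data.Vec using (Vec; []; _∷_)
open import Data.Product using (Σ; Σ-syntax; _×_; ∃-syntax; proj₁)
open import Data.Rational as ℚ using (ℚ; 0ℚ; 1ℚ)
open import Relation.Binary.PropositionalEquality using (_≡_)
open import Relation.Nullary using (¬_; Dec; yes; no)
open import Relation.Nullary.Decidable using (⌊_⌋)
import Data.Fin.Subset as Sub
open import Function using (_∘_)

sumℕ : (n : ℕ) → (Fin n → ℕ) → ℕ
sumℕ zero    f = 0
sumℕ (suc n) f = f zero ℕ.+ sumℕ n (f ∘ suc)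

sumℚ : (n : ℕ) → (Fin n → ℚ) → ℚ
sumℚ zero    f = 0ℚ
sumℚ (suc n) f = f zero ℚ.+ sumℚ n (f ∘ suc)

sumSubsets : (n : ℕ) → (Sub.Subset n → ℕ) → ℕ
sumSubsets zero    f = f []
sumSubsets (suc n) f = sumSubsets n (λ s → f (false ∷ s)) ℕ.+ sumSubsets n (λ s → f (true ∷ s))

prodOver : {n : ℕ} → Sub.Subset n → (Fin n → ℕ) → ℕ
prodOver []          x = 1
prodOver (false ∷ s) x = prodOver s (x ∘ suc)
prodOver (true ∷ s)  x = x zero ℕ.* prodOver s (x ∘ suc)

S : (j : ℕ) → {n : ℕ} → (Fin n → ℕ) → ℕ
S j {n} x = sumSubsets n (λ T → if ⌊ Sub.∣ T ∣ ℕ.≟ j ⌋ then prodOver T x else 0)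

R : (k : ℕ) → {ℓ : ℕ} → (Fin ℓ → ℕ) → ℕ
R k {ℓ} b = sumℕ (suc k) (λ j → S (Data.Fin.toℕ j) (λ i → b i ∸ 1))

-- Words.  Σ_B = Π_i Σ_{b_i} ; Δ_B = Π_i (Σ_{b_i} ∪ {g}) with g = nothing.

ΣB : {ℓ : ℕ} → (Fin ℓ → ℕ) → Set
ΣB {ℓ} b = (i : Fin ℓ) → Fin (b i)

ΔB : {ℓ : ℕ} → (Fin ℓ → ℕ) → Set
ΔB {ℓ} b = (i : Fin ℓ) → Maybe (Fin (b i))

isGap : {m : ℕ} → Maybe (Fin m) → ℕ
isGap nothing  = 1
isGap (just _) = 0

gaps : {ℓ : ℕ} {b : Fin ℓ → ℕ} → ΔB b → ℕ
gaps {ℓ} v = sumℕ ℓ (λ i → isGap (v i))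

V : (ℓ k : ℕ) → (Fin ℓ → ℕ) → Set
V ℓ k b = Σ[ v ∈ ΔB b ] gaps v ≡ ℓ ∸ k

Matchable : {ℓ : ℕ} {b : Fin ℓ → ℕ} → ΣB b → ΔB b → Set
Matchable {ℓ} u v = ∀ i x → v i ≡ just x → u i ≡ x

matchCoord? : {m : ℕ} (a : Fin m) (c : Maybe (Fin m)) → Dec (∀ x → c ≡ just x → a ≡ x)
matchCoord? a nothing  = yes λ x ()
matchCoord? a (just y) with a FinP.≟ y
... | yes a≡y = yes λ { x _≡_.refl → a≡y }
... | no  a≢y = no λ h → a≢y (h y _≡_.refl)

matchable? : {ℓ : ℕ} {b : Fin ℓ → ℕ} (u : ΣB b) (v : ΔB b) → Dec (Matchable u v)
matchable? u v = FinP.all? (λ i → matchCoord? (u i) (v i))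

A : (ℓ k : ℕ) (b : Fin ℓ → ℕ) → V ℓ k b → ΣB b → ℚ
A ℓ k b v u = if ⌊ matchable? u (proj₁ v) ⌋ then 1ℚ else 0ℚ

sumΣB : (ℓ : ℕ) (b : Fin ℓ → ℕ) → (ΣB b → ℚ) → ℚ
sumΣB zero    b f = f (λ ())
sumΣB (suc ℓ) b f =
  sumℚ (b zero) (λ x → sumΣB ℓ (b ∘ suc) (λ u → f (λ { zero → x ; (suc i) → u i })))

AAᵀ : (ℓ k : ℕ) (b : Fin ℓ → ℕ) → V ℓ k b → V ℓ k b → ℚ
AAᵀ ℓ k b v w = sumΣB ℓ b (λ u → A ℓ k b v u ℚ.* A ℓ k b w u)

LinIndep : {n : ℕ} {C : Set} → (Fin n → C → ℚ) → Set
LinIndep {n} {C} rows =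
  (c : Fin n → ℚ) → (∀ col → sumℚ n (λ i → c i ℚ.* rows i col) ≡ 0ℚ) → ∀ i → c i ≡ 0ℚ

IsRank : {Row Col : Set} → (Row → Col → ℚ) → ℕ → Set
IsRank {Row} M r =
  (Σ[ f ∈ (Fin r → Row) ] LinIndep (M ∘ f)) ×
  ((f : Fin (suc r) → Row) → ¬ LinIndep (M ∘ f))

-- Sort the rows of A_{ℓ,k;B} by their first coordinate; write B′ = (b₂,…,b_ℓ) and m = b₁ − 1.
-- For k < ℓ a basis of the row space is given by the rows gap·w, with w running through a basis for
-- (B′, k), together with the rows a·w for the letters a = 1,…,m and w running through a basis for
-- (B′, k − 1); for k = ℓ there are no gaps and all b₁ letters are used. A row 0·w is reached as
-- ĝ − Σ_{a ≥ 1} a·w, where ĝ(u) = A′w(u₂…u_ℓ) lies in the span of the gap rows because a row with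
-- k − 1 letters is the sum of the rows obtained by filling one of its gaps with every letter. This
-- gives R_k(B) = R_k(B′) + m R_{k−1}(B′). The same rows are independent in A Aᵀ, as a combination x
-- of rows of A killed by A Aᵀ has x xᵀ = 0, and a basis of size r forces rank r by Steinitz exchange.

module Submission where

open import Defs
open import Data.Nat using (ℕ; _≤_)
open import Data.Fin using (Fin)
open import Data.Product using (_×_)

open import Data.Bool using (true; false; if_then_else_)
open import Data.Empty using (⊥-elim)
open import Data.Fin as Fin using (zero; suc; punchIn; punchOut; _↑ˡ_; _↑ʳ_; splitAt; combine; remQuot)
import Data.Fin.Properties as FinP
open import Data.Fin.Subset using (Subset; ∣_∣)
open import Data.Maybe using (Maybe; just; nothing)
open import Data.Nat as ℕ using (zero; suc; z≤n; s≤s; _<_; _∸_)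
import Data.Nat.Properties as ℕP
open import Data.Product using (Σ-syntax; _,_; proj₁; proj₂)
open import Data.Rational as ℚ using (ℚ; 0ℚ; 1ℚ; _+_; _*_; -_; _-_; 1/_; ≢-nonZero; nonNegative)
  renaming (_≤_ to _≤ℚ_)
import Data.Rational.Properties as ℚP
open import Data.Rational.Solver using (module +-*-Solver)
open import Data.Sum using (inj₁; inj₂)
open import Data.Vec using ([]; _∷_)
open import Data.Vec.Functional using (_++_)
open import Data.Vec.Functional.Properties using (lookup-++ˡ; lookup-++ʳ)
open import Function using (_∘_)
open import Function.Bundles using (mk⇔)
open import Relation.Binary.PropositionalEquality
open import Relation.Nullary using (¬_; Dec; yes; no)
open import Relation.Nullary.Decidable using (⌊_⌋; does-⇔; isYes≗does)
open import Algebra.Properties.CommutativeSemigroup ℕP.+-commutativeSemigroup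
  using () renaming (interchange to +-interchange)
open import Algebra.Properties.Group ℚP.+-0-group using (x∙y⁻¹≈ε⇒x≈y)

open +-*-Solver using (solve; _:+_; _:-_; _:*_; :-_; _:=_; con)

𝟙 : {P : Set} → Dec P → ℚ
𝟙 P? = if ⌊ P? ⌋ then 1ℚ else 0ℚ

𝟙-⇔ : {P Q : Set} (P? : Dec P) (Q? : Dec Q) → (P → Q) → (Q → P) → 𝟙 P? ≡ 𝟙 Q?
𝟙-⇔ (yes p) (yes q) _ _ = refl
𝟙-⇔ (no ¬p) (no ¬q) _ _ = refl
𝟙-⇔ (yes p) (no ¬q) f _ = ⊥-elim (¬q (f p))
𝟙-⇔ (no ¬p) (yes q) _ g = ⊥-elim (¬p (g q))

𝟙-× : {P Q T : Set} (P? : Dec P) (Q? : Dec Q) (T? : Dec T) →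
      (P → Q) → (P → T) → (Q → T → P) → 𝟙 P? ≡ 𝟙 Q? * 𝟙 T?
𝟙-× (yes _) (yes _) (yes _) _ _ _ = refl
𝟙-× (yes p) (no ¬q) _       f _ _ = ⊥-elim (¬q (f p))
𝟙-× (yes p) (yes _) (no ¬t) _ g _ = ⊥-elim (¬t (g p))
𝟙-× (no ¬p) (yes q) (yes t) _ _ h = ⊥-elim (¬p (h q t))
𝟙-× (no _)  (yes _) (no _)  _ _ _ = refl
𝟙-× (no _)  (no _)  (yes _) _ _ _ = refl
𝟙-× (no _)  (no _)  (no _)  _ _ _ = refl

δ : {n : ℕ} → Fin n → Fin n → ℚ
δ i j = 𝟙 (i FinP.≟ j)

𝟙-no : {P : Set} (P? : Dec P) → ¬ P → 𝟙 P? ≡ 0ℚ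
𝟙-no (yes p) ¬p = ⊥-elim (¬p p)
𝟙-no (no _)  _  = refl

δ-off : ∀ {n} {i j : Fin n} → i ≢ j → δ i j ≡ 0ℚ
δ-off {i = i} {j} = 𝟙-no (i FinP.≟ j)

δ-injective : ∀ {m n} (f : Fin m → Fin n) → (∀ {a c} → f a ≡ f c → a ≡ c) →
              ∀ a c → δ (f a) (f c) ≡ δ a c
δ-injective f f-inj a c = 𝟙-⇔ (f a FinP.≟ f c) (a FinP.≟ c) f-inj (cong f)

sumℚ-cong : ∀ n {f g : Fin n → ℚ} → (∀ i → f i ≡ g i) → sumℚ n f ≡ sumℚ n g
sumℚ-cong zero    f≗g = refl
sumℚ-cong (suc n) f≗g = cong₂ _+_ (f≗g zero) (sumℚ-cong n (f≗g ∘ suc))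

sumℚ-zeros : ∀ n {f : Fin n → ℚ} → (∀ i → f i ≡ 0ℚ) → sumℚ n f ≡ 0ℚ
sumℚ-zeros zero    f≗0 = refl
sumℚ-zeros (suc n) f≗0 = cong₂ _+_ (f≗0 zero) (sumℚ-zeros n (f≗0 ∘ suc))

sumℚ-distrib-+ : ∀ n (f g : Fin n → ℚ) → sumℚ n (λ i → f i + g i) ≡ sumℚ n f + sumℚ n g
sumℚ-distrib-+ zero    f g = refl
sumℚ-distrib-+ (suc n) f g = begin
  (f zero + g zero) + sumℚ n (λ i → f (suc i) + g (suc i))
    ≡⟨ cong (f zero + g zero +_) (sumℚ-distrib-+ n (f ∘ suc) (g ∘ suc)) ⟩
  (f zero + g zero) + (sumℚ n (f ∘ suc) + sumℚ n (g ∘ suc))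
    ≡⟨ solve 4 (λ a b c d → (a :+ b) :+ (c :+ d) := (a :+ c) :+ (b :+ d))
               refl (f zero) (g zero) (sumℚ n (f ∘ suc)) (sumℚ n (g ∘ suc)) ⟩
  (f zero + sumℚ n (f ∘ suc)) + (g zero + sumℚ n (g ∘ suc)) ∎
  where open ≡-Reasoning

*-distribˡ-sumℚ : ∀ n a (f : Fin n → ℚ) → a * sumℚ n f ≡ sumℚ n (λ i → a * f i)
*-distribˡ-sumℚ zero    a f = ℚP.*-zeroʳ a
*-distribˡ-sumℚ (suc n) a f =
  trans (ℚP.*-distribˡ-+ a (f zero) _) (cong (a * f zero +_) (*-distribˡ-sumℚ n a (f ∘ suc)))

*-distribʳ-sumℚ : ∀ n a (f : Fin n → ℚ) → sumℚ n f * a ≡ sumℚ n (λ i → f i * a)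
*-distribʳ-sumℚ n a f = trans (ℚP.*-comm _ a)
  (trans (*-distribˡ-sumℚ n a f) (sumℚ-cong n (λ i → ℚP.*-comm a (f i))))

sumℚ-comm : ∀ m n (f : Fin m → Fin n → ℚ) →
            sumℚ m (λ i → sumℚ n (f i)) ≡ sumℚ n (λ j → sumℚ m (λ i → f i j))
sumℚ-comm zero    n f = sym (sumℚ-zeros n (λ _ → refl))
sumℚ-comm (suc m) n f = trans (cong (sumℚ n (f zero) +_) (sumℚ-comm m n (f ∘ suc)))
  (sym (sumℚ-distrib-+ n (f zero) _))

sumℚ-↑ : ∀ m n (f : Fin (m ℕ.+ n) → ℚ) →
         sumℚ (m ℕ.+ n) f ≡ sumℚ m (f ∘ (_↑ˡ n)) + sumℚ n (f ∘ (m ↑ʳ_))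
sumℚ-↑ zero    n f = sym (ℚP.+-identityˡ _)
sumℚ-↑ (suc m) n f = trans (cong (f zero +_) (sumℚ-↑ m n (f ∘ suc)))
  (sym (ℚP.+-assoc (f zero) _ _))

sumℚ-combine : ∀ m n (f : Fin (m ℕ.* n) → ℚ) →
               sumℚ (m ℕ.* n) f ≡ sumℚ m (λ x → sumℚ n (λ j → f (combine x j)))
sumℚ-combine zero    n f = refl
sumℚ-combine (suc m) n f = trans (sumℚ-↑ n (m ℕ.* n) f)
  (cong (sumℚ n (λ j → f (j ↑ˡ m ℕ.* n)) +_) (sumℚ-combine m n (f ∘ (n ↑ʳ_))))

all-↑ : ∀ m n {P : Fin (m ℕ.+ n) → Set} → (∀ i → P (i ↑ˡ n)) → (∀ j → P (m ↑ʳ j)) → ∀ i → P i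
all-↑ m n P↑ˡ P↑ʳ i with splitAt m i | FinP.join-splitAt m n i
... | inj₁ i′ | refl = P↑ˡ i′
... | inj₂ j  | refl = P↑ʳ j

all-combine : ∀ m n {P : Fin (m ℕ.* n) → Set} → (∀ x j → P (combine x j)) → ∀ i → P i
all-combine m n {P} P-combine i =
  subst P (FinP.combine-remQuot {m} n i) (P-combine (proj₁ (remQuot {m} n i)) (proj₂ (remQuot {m} n i)))

sumℚ-δ : ∀ {n} (i : Fin n) (f : Fin n → ℚ) → sumℚ n (λ j → δ i j * f j) ≡ f i
sumℚ-δ {suc n} zero f = begin
  δ {suc n} zero zero * f zero + sumℚ n (λ j → δ zero (suc j) * f (suc j))
    ≡⟨ cong₂ _+_ (ℚP.*-identityˡ (f zero))
               (sumℚ-zeros n λ j → trans (cong (_* f (suc j)) (δ-off {i = zero} {suc j} λ ()))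
                                         (ℚP.*-zeroˡ (f (suc j)))) ⟩
  f zero + 0ℚ
    ≡⟨ ℚP.+-identityʳ (f zero) ⟩
  f zero ∎
  where open ≡-Reasoning
sumℚ-δ {suc n} (suc i) f = begin
  δ (suc i) zero * f zero + sumℚ n (λ j → δ (suc i) (suc j) * f (suc j))
    ≡⟨ cong₂ _+_ (trans (cong (_* f zero) (δ-off {i = suc i} {zero} λ ())) (ℚP.*-zeroˡ (f zero)))
               (sumℚ-cong n (λ j → cong (_* f (suc j)) (δ-injective suc FinP.suc-injective i j))) ⟩
  0ℚ + sumℚ n (λ j → δ i j * f (suc j))
    ≡⟨ trans (ℚP.+-identityˡ _) (sumℚ-δ i (f ∘ suc)) ⟩
  f (suc i) ∎
  where open ≡-Reasoning

module _ {Row Col : Set} (M : Row → Col → ℚ) where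

  lincomb : ∀ {n} → (Fin n → ℚ) → (Fin n → Row) → Col → ℚ
  lincomb {n} α r u = sumℚ n (λ i → α i * M (r i) u)

  InSpan : ∀ {n} → (Fin n → Row) → (Col → ℚ) → Set
  InSpan {n} r f = Σ[ α ∈ (Fin n → ℚ) ] (∀ u → f u ≡ lincomb α r u)

  Spans : ∀ {n} → (Fin n → Row) → Set
  Spans r = ∀ v → InSpan r (M v)

record Basis {Row Col : Set} (M : Row → Col → ℚ) (n : ℕ) : Set where
  field
    row         : Fin n → Row
    independent : LinIndep (M ∘ row)
    spanning    : Spans M row

IsSumOfRows : {Row Col : Set} → (Row → Col → ℚ) → (Col → ℚ) → Set
IsSumOfRows {Row} M f = Σ[ N ∈ ℕ ] Σ[ W ∈ (Fin N → Row) ] (∀ u → f u ≡ sumℚ N (λ t → M (W t) u))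

module _ {Row Col : Set} {M : Row → Col → ℚ} {n : ℕ} {r : Fin n → Row} where

  InSpan-cong : {f g : Col → ℚ} → (∀ u → f u ≡ g u) → InSpan M r g → InSpan M r f
  InSpan-cong f≗g (α , g≗α) = α , λ u → trans (f≗g u) (g≗α u)

  InSpan-row : ∀ i → InSpan M r (M (r i))
  InSpan-row i = δ i , λ u → sym (sumℚ-δ i (λ j → M (r j) u))

  InSpan-zero : InSpan M r (λ _ → 0ℚ)
  InSpan-zero = (λ _ → 0ℚ) , λ u → sym (sumℚ-zeros n (λ i → ℚP.*-zeroˡ (M (r i) u)))

  InSpan-+ : {f g : Col → ℚ} → InSpan M r f → InSpan M r g → InSpan M r (λ u → f u + g u)
  InSpan-+ {f} {g} (α , f≗α) (β , g≗β) = (λ i → α i + β i) , λ u → begin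
    f u + g u                                            ≡⟨ cong₂ _+_ (f≗α u) (g≗β u) ⟩
    lincomb M α r u + lincomb M β r u                    ≡⟨ sumℚ-distrib-+ n _ _ ⟨
    sumℚ n (λ i → α i * M (r i) u + β i * M (r i) u)
      ≡⟨ sumℚ-cong n (λ i → ℚP.*-distribʳ-+ (M (r i) u) (α i) (β i)) ⟨
    lincomb M (λ i → α i + β i) r u                      ∎
    where open ≡-Reasoning

  InSpan-scale : ∀ a {f : Col → ℚ} → InSpan M r f → InSpan M r (λ u → a * f u)
  InSpan-scale a {f} (α , f≗α) = (λ i → a * α i) , λ u → begin
    a * f u                                   ≡⟨ cong (a *_) (f≗α u) ⟩
    a * lincomb M α r u                       ≡⟨ *-distribˡ-sumℚ n a _ ⟩
    sumℚ n (λ i → a * (α i * M (r i) u))      ≡⟨ sumℚ-cong n (λ i → ℚP.*-assoc a (α i) _) ⟨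
    lincomb M (λ i → a * α i) r u             ∎
    where open ≡-Reasoning

  InSpan-sum : ∀ N (f : Fin N → Col → ℚ) → (∀ t → InSpan M r (f t)) →
               InSpan M r (λ u → sumℚ N (λ t → f t u))
  InSpan-sum zero    f f∈ = InSpan-zero
  InSpan-sum (suc N) f f∈ = InSpan-+ (f∈ zero) (InSpan-sum N (f ∘ suc) (f∈ ∘ suc))

  InSpan-lincomb : ∀ {m} {r′ : Fin m → Row} → (∀ j → InSpan M r (M (r′ j))) →
                   ∀ {f} → InSpan M r′ f → InSpan M r f
  InSpan-lincomb {m} r′⊆ (β , f≗β) =
    InSpan-cong f≗β (InSpan-sum m _ (λ j → InSpan-scale (β j) (r′⊆ j)))

  InSpan-row′ : ∀ {i v} → r i ≡ v → InSpan M r (M v)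
  InSpan-row′ {i} refl = InSpan-row i

  InSpan-sumOfRows : Spans M r → ∀ {f} → IsSumOfRows M f → InSpan M r f
  InSpan-sumOfRows r-spans (N , W , f≡ΣW) = InSpan-cong f≡ΣW (InSpan-sum N _ (λ t → r-spans (W t)))

module _ {Row Col : Set} {M : Row → Col → ℚ} {n₁ n₂ : ℕ} (r₁ : Fin n₁ → Row) (r₂ : Fin n₂ → Row) where

  lincomb-++ : ∀ α u → lincomb M α (r₁ ++ r₂) u ≡
                       lincomb M (α ∘ (_↑ˡ n₂)) r₁ u + lincomb M (α ∘ (n₁ ↑ʳ_)) r₂ u
  lincomb-++ α u = trans (sumℚ-↑ n₁ n₂ _) (cong₂ _+_
    (sumℚ-cong n₁ (λ i → cong (λ v → α (i ↑ˡ n₂) * M v u) (lookup-++ˡ r₁ r₂ i)))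
    (sumℚ-cong n₂ (λ j → cong (λ v → α (n₁ ↑ʳ j) * M v u) (lookup-++ʳ r₁ r₂ j))))

  InSpan-++ˡ : ∀ {f} → InSpan M r₁ f → InSpan M (r₁ ++ r₂) f
  InSpan-++ˡ = InSpan-lincomb {M = M} {r = r₁ ++ r₂} (λ i → InSpan-row′ {M = M} (lookup-++ˡ r₁ r₂ i))

  InSpan-++ʳ : ∀ {f} → InSpan M r₂ f → InSpan M (r₁ ++ r₂) f
  InSpan-++ʳ = InSpan-lincomb {M = M} {r = r₁ ++ r₂} (λ j → InSpan-row′ {M = M} (lookup-++ʳ r₁ r₂ j))

module _ {Row Row′ Col Col′ : Set} {M : Row → Col → ℚ} {M′ : Row′ → Col′ → ℚ}
         (g : Row′ → Row) (φ : Col → ℚ) (τ : Col → Col′) (M∘g : ∀ v u → M (g v) u ≡ φ u * M′ v (τ u)) where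

  lincomb-map : ∀ {n} α (r : Fin n → Row′) u → lincomb M α (g ∘ r) u ≡ φ u * lincomb M′ α r (τ u)
  lincomb-map {n} α r u = trans
    (sumℚ-cong n (λ i → trans (cong (α i *_) (M∘g (r i) u))
      (solve 3 (λ a f m → a :* (f :* m) := f :* (a :* m)) refl (α i) (φ u) (M′ (r i) (τ u)))))
    (sym (*-distribˡ-sumℚ n (φ u) _))

  InSpan-map : ∀ {n} {r : Fin n → Row′} {f} → InSpan M′ r f → InSpan M (g ∘ r) (λ u → φ u * f (τ u))
  InSpan-map {r = r} (α , f≡α) = α , λ u → trans (cong (φ u *_) (f≡α (τ u))) (sym (lincomb-map α r u))

-- Steinitz exchange

zeroRow⇒¬LinIndep : ∀ {m} {C : Set} (w : Fin (suc m) → C → ℚ) → (∀ c → w zero c ≡ 0ℚ) → ¬ LinIndep w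
zeroRow⇒¬LinIndep w w₀≡0 indep with indep (δ zero) (λ c → trans (sumℚ-δ zero (λ i → w i c)) (w₀≡0 c)) zero
... | ()

module Elimination {m n : ℕ} (w : Fin (suc m) → Fin (suc n) → ℚ)
                   (q : Fin (suc n)) (pivot≢0 : w zero q ≢ 0ℚ) where

  pivot⁻¹ : ℚ
  pivot⁻¹ = (1/ w zero q) {{≢-nonZero pivot≢0}}

  reduced : Fin m → Fin n → ℚ
  reduced j i = w (suc j) (punchIn q i) - w (suc j) q * (pivot⁻¹ * w zero (punchIn q i))

  -- a relation d among the reduced rows, completed by the right coefficient of the first row,
  -- is a relation among the rows of w
  reduced-LinIndep : LinIndep w → LinIndep reduced
  reduced-LinIndep indep d d-rel j = indep c c-rel (suc j)
    where
    T : Fin (suc n) → ℚ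
    T col = sumℚ m (λ j → d j * w (suc j) col)

    σ : ℚ
    σ = T q

    c : Fin (suc m) → ℚ
    c zero    = - (σ * pivot⁻¹)
    c (suc j) = d j

    d-rel′ : ∀ i → T (punchIn q i) - σ * (pivot⁻¹ * w zero (punchIn q i)) ≡ 0ℚ
    d-rel′ i = trans (sym (begin
      sumℚ m (λ j → d j * reduced j i)
        ≡⟨ sumℚ-cong m (λ j → solve 4 (λ d a b s → d :* (a :- b :* s) := d :* a :+ (:- s) :* (d :* b))
                                    refl (d j) (w (suc j) (punchIn q i)) (w (suc j) q) s) ⟩
      sumℚ m (λ j → d j * w (suc j) (punchIn q i) + - s * (d j * w (suc j) q))
        ≡⟨ trans (sumℚ-distrib-+ m _ _) (cong (T (punchIn q i) +_) (sym (*-distribˡ-sumℚ m (- s) _))) ⟩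
      T (punchIn q i) + - s * σ
        ≡⟨ solve 3 (λ t s σ → t :+ (:- s) :* σ := t :- σ :* s) refl (T (punchIn q i)) s σ ⟩
      T (punchIn q i) - σ * s ∎)) (d-rel i)
      where
      open ≡-Reasoning
      s : ℚ
      s = pivot⁻¹ * w zero (punchIn q i)

    T≡ : ∀ col → T col ≡ σ * (pivot⁻¹ * w zero col)
    T≡ col with col FinP.≟ q
    ... | yes refl =
      sym (trans (cong (σ *_) (ℚP.*-inverseˡ (w zero q) {{≢-nonZero pivot≢0}})) (ℚP.*-identityʳ σ))
    ... | no col≢q = subst (λ col → T col ≡ σ * (pivot⁻¹ * w zero col))
                           (FinP.punchIn-punchOut (col≢q ∘ sym))
                           (x∙y⁻¹≈ε⇒x≈y _ _ (d-rel′ (punchOut (col≢q ∘ sym))))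

    c-rel : ∀ col → sumℚ (suc m) (λ j → c j * w j col) ≡ 0ℚ
    c-rel col = trans (cong (c zero * w zero col +_) (T≡ col))
      (solve 3 (λ σ p x → (:- (σ :* p)) :* x :+ σ :* (p :* x) := con 0ℚ) refl σ pivot⁻¹ (w zero col))

steinitz : ∀ {m n} → n < m → (w : Fin m → Fin n → ℚ) → ¬ LinIndep w
steinitz {suc m} {zero}  _          w = zeroRow⇒¬LinIndep w (λ ())
steinitz {suc m} {suc n} (s≤s n<m) w indep with FinP.all? (λ i → w zero i ℚP.≟ 0ℚ)
... | yes w₀≡0 = zeroRow⇒¬LinIndep w w₀≡0 indep
... | no  w₀≢0 with FinP.¬∀⟶∃¬ _ _ (λ i → w zero i ℚP.≟ 0ℚ) w₀≢0
...   | q , pivot≢0 = steinitz n<m reduced (reduced-LinIndep indep)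
  where open Elimination w q pivot≢0

LinIndep-coordinates : ∀ {m n} {C : Set} (v : Fin m → C → ℚ) (e : Fin n → C → ℚ) (w : Fin m → Fin n → ℚ) →
                       (∀ j c → v j c ≡ sumℚ n (λ i → w j i * e i c)) →
                       LinIndep v → LinIndep w
LinIndep-coordinates {m} {n} v e w v≡we indep a a-rel = indep a λ c → begin
  sumℚ m (λ j → a j * v j c)
    ≡⟨ sumℚ-cong m (λ j → trans (cong (a j *_) (v≡we j c)) (*-distribˡ-sumℚ n (a j) _)) ⟩
  sumℚ m (λ j → sumℚ n (λ i → a j * (w j i * e i c)))
    ≡⟨ sumℚ-comm m n _ ⟩
  sumℚ n (λ i → sumℚ m (λ j → a j * (w j i * e i c)))
    ≡⟨ sumℚ-cong n (λ i → trans (sumℚ-cong m (λ j → sym (ℚP.*-assoc (a j) _ _)))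
                                (sym (*-distribʳ-sumℚ m (e i c) _))) ⟩
  sumℚ n (λ i → sumℚ m (λ j → a j * w j i) * e i c)
    ≡⟨ sumℚ-zeros n (λ i → trans (cong (_* e i c) (a-rel i)) (ℚP.*-zeroˡ (e i c))) ⟩
  0ℚ ∎
  where open ≡-Reasoning

Basis⇒IsRank : ∀ {Row Col : Set} {M : Row → Col → ℚ} {n} → Basis M n → IsRank M n
Basis⇒IsRank {Row} {M = M} {n} B = (row , independent) , λ f indep →
  steinitz (ℕP.n<1+n n) (coordinates f)
    (LinIndep-coordinates (M ∘ f) (M ∘ row) (coordinates f) (λ j → proj₂ (spanning (f j))) indep)
  where
  open Basis B
  coordinates : (Fin (suc n) → Row) → Fin (suc n) → Fin n → ℚ
  coordinates f j = proj₁ (spanning (f j))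

nonneg-+-zeroˡ : ∀ {a b} → 0ℚ ≤ℚ a → 0ℚ ≤ℚ b → a + b ≡ 0ℚ → a ≡ 0ℚ
nonneg-+-zeroˡ {a} {b} 0≤a 0≤b a+b≡0 =
  ℚP.≤-antisym (subst₂ _≤ℚ_ (ℚP.+-identityʳ a) a+b≡0 (ℚP.+-monoʳ-≤ a 0≤b)) 0≤a

sumℚ-nonneg : ∀ n {f : Fin n → ℚ} → (∀ i → 0ℚ ≤ℚ f i) → 0ℚ ≤ℚ sumℚ n f
sumℚ-nonneg zero    _     = ℚP.≤-refl
sumℚ-nonneg (suc n) 0≤f = ℚP.+-mono-≤ (0≤f zero) (sumℚ-nonneg n (0≤f ∘ suc))

sumℚ-nonneg-zero : ∀ n {f : Fin n → ℚ} → (∀ i → 0ℚ ≤ℚ f i) → sumℚ n f ≡ 0ℚ → ∀ i → f i ≡ 0ℚ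
sumℚ-nonneg-zero (suc n) {f} 0≤f Σf≡0 = λ where
    zero    → f₀≡0
    (suc i) → sumℚ-nonneg-zero n (0≤f ∘ suc)
                (trans (sym (ℚP.+-identityˡ _)) (trans (cong (_+ sumℚ n (f ∘ suc)) (sym f₀≡0)) Σf≡0)) i
  where
  f₀≡0 : f zero ≡ 0ℚ
  f₀≡0 = nonneg-+-zeroˡ (0≤f zero) (sumℚ-nonneg n (0≤f ∘ suc)) Σf≡0

square-nonneg : ∀ p → 0ℚ ≤ℚ p * p
square-nonneg p with ℚP.≤-total 0ℚ p
... | inj₁ 0≤p = ℚP.nonNegative⁻¹ _ {{ℚP.nonNeg*nonNeg⇒nonNeg p {{0≤p′}} p {{0≤p′}}}}
  where
  0≤p′ : ℚ.NonNegative p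
  0≤p′ = nonNegative 0≤p
... | inj₂ p≤0 = subst (0ℚ ≤ℚ_) (solve 1 (λ p → (:- p) :* (:- p) := p :* p) refl p)
    (ℚP.nonNegative⁻¹ _ {{ℚP.nonNeg*nonNeg⇒nonNeg (- p) {{0≤-p}} (- p) {{0≤-p}}}})
  where
  0≤-p : ℚ.NonNegative (- p)
  0≤-p = nonNegative (ℚP.neg-antimono-≤ p≤0)

square-zero : ∀ p → p * p ≡ 0ℚ → p ≡ 0ℚ
square-zero p p²≡0 with p ℚP.≟ 0ℚ
... | yes p≡0 = p≡0
... | no  p≢0 = begin
  p                ≡⟨ ℚP.*-identityˡ p ⟨
  1ℚ * p           ≡⟨ cong (_* p) (ℚP.*-inverseˡ p) ⟨
  (1/ p) * p * p   ≡⟨ ℚP.*-assoc (1/ p) p p ⟩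
  (1/ p) * (p * p) ≡⟨ cong (1/ p *_) p²≡0 ⟩
  (1/ p) * 0ℚ      ≡⟨ ℚP.*-zeroʳ (1/ p) ⟩
  0ℚ               ∎
  where
  open ≡-Reasoning
  instance _ = ≢-nonZero p≢0

Extensional : ∀ {ℓ} {b : Fin ℓ → ℕ} → (ΣB b → ℚ) → Set
Extensional f = ∀ {u u′} → (∀ i → u i ≡ u′ i) → f u ≡ f u′

infixr 5 _∷ᵤ_

_∷ᵤ_ : ∀ {ℓ} {b : Fin (suc ℓ) → ℕ} → Fin (b zero) → ΣB (b ∘ suc) → ΣB b
(x ∷ᵤ u) zero    = x
(x ∷ᵤ u) (suc i) = u i

tailᵤ : ∀ {ℓ} {b : Fin (suc ℓ) → ℕ} → ΣB b → ΣB (b ∘ suc)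
tailᵤ u = u ∘ suc

sumΣB-cong : ∀ ℓ b {f g : ΣB {ℓ} b → ℚ} → (∀ u → f u ≡ g u) → sumΣB ℓ b f ≡ sumΣB ℓ b g
sumΣB-cong zero    b f≗g = f≗g _
sumΣB-cong (suc ℓ) b f≗g = sumℚ-cong (b zero) (λ x → sumΣB-cong ℓ (b ∘ suc) (λ u → f≗g _))

sumΣB-zeros : ∀ ℓ b {f : ΣB {ℓ} b → ℚ} → (∀ u → f u ≡ 0ℚ) → sumΣB ℓ b f ≡ 0ℚ
sumΣB-zeros zero    b f≗0 = f≗0 _
sumΣB-zeros (suc ℓ) b f≗0 = sumℚ-zeros (b zero) (λ x → sumΣB-zeros ℓ (b ∘ suc) (λ u → f≗0 _))

sumΣB-distrib-+ : ∀ ℓ b (f g : ΣB {ℓ} b → ℚ) → sumΣB ℓ b (λ u → f u + g u) ≡ sumΣB ℓ b f + sumΣB ℓ b g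
sumΣB-distrib-+ zero    b f g = refl
sumΣB-distrib-+ (suc ℓ) b f g =
  trans (sumℚ-cong (b zero) (λ x → sumΣB-distrib-+ ℓ (b ∘ suc) _ _)) (sumℚ-distrib-+ (b zero) _ _)

*-distribˡ-sumΣB : ∀ ℓ b a (f : ΣB {ℓ} b → ℚ) → a * sumΣB ℓ b f ≡ sumΣB ℓ b (λ u → a * f u)
*-distribˡ-sumΣB zero    b a f = refl
*-distribˡ-sumΣB (suc ℓ) b a f =
  trans (*-distribˡ-sumℚ (b zero) a _) (sumℚ-cong (b zero) (λ x → *-distribˡ-sumΣB ℓ (b ∘ suc) a _))

sumΣB-nonneg : ∀ ℓ b {f : ΣB {ℓ} b → ℚ} → (∀ u → 0ℚ ≤ℚ f u) → 0ℚ ≤ℚ sumΣB ℓ b f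
sumΣB-nonneg zero    b 0≤f = 0≤f _
sumΣB-nonneg (suc ℓ) b 0≤f = sumℚ-nonneg (b zero) (λ x → sumΣB-nonneg ℓ (b ∘ suc) (λ u → 0≤f _))

sumΣB-suc : ∀ ℓ b {f : ΣB {suc ℓ} b → ℚ} → Extensional f →
            sumΣB (suc ℓ) b f ≡ sumℚ (b zero) (λ x → sumΣB ℓ (b ∘ suc) (λ u → f (x ∷ᵤ u)))
sumΣB-suc ℓ b f-ext =
  sumℚ-cong (b zero) (λ x → sumΣB-cong ℓ (b ∘ suc) (λ u → f-ext λ { zero → refl ; (suc i) → refl }))

sumΣB-nonneg-zero : ∀ ℓ b {f : ΣB {ℓ} b → ℚ} → Extensional f → (∀ u → 0ℚ ≤ℚ f u) →
                    sumΣB ℓ b f ≡ 0ℚ → ∀ u → f u ≡ 0ℚ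
sumΣB-nonneg-zero zero    b f-ext _   Σf≡0 u = trans (f-ext λ ()) Σf≡0
sumΣB-nonneg-zero (suc ℓ) b f-ext 0≤f Σf≡0 u =
  trans (f-ext λ { zero → refl ; (suc i) → refl })
    (sumΣB-nonneg-zero ℓ (b ∘ suc) (λ eq → f-ext λ { zero → refl ; (suc i) → eq i }) (λ _ → 0≤f _)
      (sumℚ-nonneg-zero (b zero) (λ x → sumΣB-nonneg ℓ (b ∘ suc) (λ _ → 0≤f _))
        (trans (sym (sumΣB-suc ℓ b f-ext)) Σf≡0) (u zero))
      (tailᵤ u))

module _ {ℓ : ℕ} {b : Fin ℓ → ℕ} where

  ⟪_,_⟫ : (ΣB b → ℚ) → (ΣB b → ℚ) → ℚ
  ⟪ f , g ⟫ = sumΣB ℓ b (λ u → f u * g u)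

  Gram : {Row : Set} → (Row → ΣB b → ℚ) → Row → Row → ℚ
  Gram M v w = ⟪ M v , M w ⟫

  module _ {Row : Set} (M : Row → ΣB b → ℚ) where

    ⟪⟫-lincombˡ : ∀ {n} α (r : Fin n → Row) g →
                  ⟪ lincomb M α r , g ⟫ ≡ sumℚ n (λ i → α i * ⟪ M (r i) , g ⟫)
    ⟪⟫-lincombˡ {zero}  α r g = sumΣB-zeros ℓ b (λ u → ℚP.*-zeroˡ (g u))
    ⟪⟫-lincombˡ {suc n} α r g = begin
      sumΣB ℓ b (λ u → (α zero * M (r zero) u + lincomb M (α ∘ suc) (r ∘ suc) u) * g u)
        ≡⟨ sumΣB-cong ℓ b (λ u → solve 4 (λ a m l g → (a :* m :+ l) :* g := a :* (m :* g) :+ l :* g)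
                                      refl (α zero) (M (r zero) u) (lincomb M (α ∘ suc) (r ∘ suc) u) (g u)) ⟩
      sumΣB ℓ b (λ u → α zero * (M (r zero) u * g u) + lincomb M (α ∘ suc) (r ∘ suc) u * g u)
        ≡⟨ sumΣB-distrib-+ ℓ b _ _ ⟩
      sumΣB ℓ b (λ u → α zero * (M (r zero) u * g u)) + ⟪ lincomb M (α ∘ suc) (r ∘ suc) , g ⟫
        ≡⟨ cong₂ _+_ (sym (*-distribˡ-sumΣB ℓ b (α zero) _)) (⟪⟫-lincombˡ (α ∘ suc) (r ∘ suc) g) ⟩
      α zero * ⟪ M (r zero) , g ⟫ + sumℚ n (λ i → α (suc i) * ⟪ M (r (suc i)) , g ⟫) ∎
      where open ≡-Reasoning

    ⟪⟫-lincombʳ : ∀ {n} f α (r : Fin n → Row) →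
                  ⟪ f , lincomb M α r ⟫ ≡ sumℚ n (λ i → α i * ⟪ f , M (r i) ⟫)
    ⟪⟫-lincombʳ {n} f α r = trans (⟪⟫-comm f _)
      (trans (⟪⟫-lincombˡ α r f) (sumℚ-cong n (λ i → cong (α i *_) (⟪⟫-comm (M (r i)) f))))
      where
      ⟪⟫-comm : ∀ f g → ⟪ f , g ⟫ ≡ ⟪ g , f ⟫
      ⟪⟫-comm f g = sumΣB-cong ℓ b (λ u → ℚP.*-comm (f u) (g u))

    Basis-Gram : ∀ {n} → (∀ v → Extensional (M v)) → Basis M n → Basis (Gram M) n
    Basis-Gram {n} M-ext B = record
      { row         = row
      ; independent = λ c c-rel → independent c (λ u → combination-zero c c-rel u)
      ; spanning    = λ v → let (α , v≡α) = spanning v in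
          α , λ w → trans (sumΣB-cong ℓ b (λ u → cong (_* M w u) (v≡α u))) (⟪⟫-lincombˡ α row (M w))
      }
      where
      open Basis B
      combination-zero : ∀ c → (∀ w → lincomb (Gram M) c row w ≡ 0ℚ) → ∀ u → lincomb M c row u ≡ 0ℚ
      combination-zero c c-rel u = square-zero (x u)
        (sumΣB-nonneg-zero ℓ b (λ eq → cong₂ _*_ (x-ext eq) (x-ext eq)) (λ u → square-nonneg (x u)) ⟪x,x⟫≡0 u)
        where
        x : ΣB b → ℚ
        x = lincomb M c row
        x-ext : Extensional x
        x-ext eq = sumℚ-cong n (λ i → cong (c i *_) (M-ext (row i) eq))
        ⟪x,x⟫≡0 : ⟪ x , x ⟫ ≡ 0ℚ
        ⟪x,x⟫≡0 = trans (⟪⟫-lincombʳ x c row) (sumℚ-zeros n λ i →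
          trans (cong (c i *_) (trans (⟪⟫-lincombˡ c row (M (row i))) (c-rel (row i))))
                (ℚP.*-zeroʳ (c i)))

sumSubsets-cong : ∀ n {f g : Subset n → ℕ} → (∀ s → f s ≡ g s) → sumSubsets n f ≡ sumSubsets n g
sumSubsets-cong zero    f≗g = f≗g []
sumSubsets-cong (suc n) f≗g =
  cong₂ ℕ._+_ (sumSubsets-cong n (f≗g ∘ (false ∷_))) (sumSubsets-cong n (f≗g ∘ (true ∷_)))

sumSubsets-zeros : ∀ n {f : Subset n → ℕ} → (∀ s → f s ≡ 0) → sumSubsets n f ≡ 0
sumSubsets-zeros zero    f≗0 = f≗0 []
sumSubsets-zeros (suc n) f≗0 =
  cong₂ ℕ._+_ (sumSubsets-zeros n (f≗0 ∘ (false ∷_))) (sumSubsets-zeros n (f≗0 ∘ (true ∷_)))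

*-distribˡ-sumSubsets : ∀ n a (f : Subset n → ℕ) → a ℕ.* sumSubsets n f ≡ sumSubsets n (λ s → a ℕ.* f s)
*-distribˡ-sumSubsets zero    a f = refl
*-distribˡ-sumSubsets (suc n) a f = trans (ℕP.*-distribˡ-+ a _ _)
  (cong₂ ℕ._+_ (*-distribˡ-sumSubsets n a _) (*-distribˡ-sumSubsets n a _))

S-zero : ∀ {n} (x : Fin n → ℕ) → S 0 x ≡ 1
S-zero {zero}  x = refl
S-zero {suc n} x = trans (cong (S 0 (x ∘ suc) ℕ.+_) (sumSubsets-zeros n (λ _ → refl)))
  (trans (ℕP.+-identityʳ _) (S-zero (x ∘ suc)))

S-suc : ∀ j {n} (x : Fin (suc n) → ℕ) → S (suc j) x ≡ S (suc j) (x ∘ suc) ℕ.+ x zero ℕ.* S j (x ∘ suc)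
S-suc j {n} x = cong (S (suc j) (x ∘ suc) ℕ.+_) (trans
  (sumSubsets-cong n λ s →
    trans (cong (λ t → if t then x zero ℕ.* prodOver s (x ∘ suc) else 0) (≟-suc ∣ s ∣ j))
          (if-* ⌊ ∣ s ∣ ℕ.≟ j ⌋ {x zero} {prodOver s (x ∘ suc)}))
  (sym (*-distribˡ-sumSubsets n (x zero) (λ s → if ⌊ ∣ s ∣ ℕ.≟ j ⌋ then prodOver s (x ∘ suc) else 0))))
  where
  ≟-suc : ∀ a j → ⌊ suc a ℕ.≟ suc j ⌋ ≡ ⌊ a ℕ.≟ j ⌋
  ≟-suc a j = trans (isYes≗does _)
    (trans (does-⇔ (mk⇔ ℕP.suc-injective (cong suc)) (suc a ℕ.≟ suc j) (a ℕ.≟ j)) (sym (isYes≗does _)))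
  if-* : ∀ t {a p} → (if t then a ℕ.* p else 0) ≡ a ℕ.* (if t then p else 0)
  if-* true        = refl
  if-* false {a} = sym (ℕP.*-zeroʳ a)

sumℕ-cong : ∀ n {f g : Fin n → ℕ} → (∀ i → f i ≡ g i) → sumℕ n f ≡ sumℕ n g
sumℕ-cong zero    f≗g = refl
sumℕ-cong (suc n) f≗g = cong₂ ℕ._+_ (f≗g zero) (sumℕ-cong n (f≗g ∘ suc))

sumℕ-distrib-+ : ∀ n (f g : Fin n → ℕ) → sumℕ n (λ i → f i ℕ.+ g i) ≡ sumℕ n f ℕ.+ sumℕ n g
sumℕ-distrib-+ zero    f g = refl
sumℕ-distrib-+ (suc n) f g = trans (cong (f zero ℕ.+ g zero ℕ.+_) (sumℕ-distrib-+ n (f ∘ suc) (g ∘ suc)))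
  (+-interchange (f zero) (g zero) _ _)

*-distribˡ-sumℕ : ∀ n a (f : Fin n → ℕ) → a ℕ.* sumℕ n f ≡ sumℕ n (λ i → a ℕ.* f i)
*-distribˡ-sumℕ zero    a f = ℕP.*-zeroʳ a
*-distribˡ-sumℕ (suc n) a f =
  trans (ℕP.*-distribˡ-+ a (f zero) _) (cong (a ℕ.* f zero ℕ.+_) (*-distribˡ-sumℕ n a (f ∘ suc)))

R-zero : ∀ {ℓ} (b : Fin ℓ → ℕ) → R 0 b ≡ 1
R-zero b = trans (ℕP.+-identityʳ _) (S-zero (λ i → b i ∸ 1))

R-empty : ∀ k (b : Fin 0 → ℕ) → R k b ≡ 1
R-empty k b = cong suc (higher-S-vanish k)
  where
  higher-S-vanish : ∀ n → sumℕ n (λ j → S (Fin.toℕ (suc j)) b) ≡ 0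
  higher-S-vanish zero    = refl
  higher-S-vanish (suc n) = higher-S-vanish n

R-suc : ∀ k {ℓ} (b : Fin (suc ℓ) → ℕ) → R (suc k) b ≡ R (suc k) (b ∘ suc) ℕ.+ (b zero ∸ 1) ℕ.* R k (b ∘ suc)
R-suc k {ℓ} b = begin
  S 0 x ℕ.+ sumℕ (suc k) (λ j → S (suc (Fin.toℕ j)) x)
    ≡⟨ cong₂ ℕ._+_ (trans (S-zero x) (sym (S-zero x′)))
                   (trans (sumℕ-cong (suc k) (λ j → S-suc (Fin.toℕ j) x))
                          (sumℕ-distrib-+ (suc k) (λ j → S (suc (Fin.toℕ j)) x′)
                                                  (λ j → x zero ℕ.* S (Fin.toℕ j) x′))) ⟩
  S 0 x′ ℕ.+ (sumℕ (suc k) (λ j → S (suc (Fin.toℕ j)) x′) ℕ.+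
              sumℕ (suc k) (λ j → x zero ℕ.* S (Fin.toℕ j) x′))
    ≡⟨ ℕP.+-assoc (S 0 x′) _ _ ⟨
  R (suc k) (b ∘ suc) ℕ.+ sumℕ (suc k) (λ j → x zero ℕ.* S (Fin.toℕ j) x′)
    ≡⟨ cong (R (suc k) (b ∘ suc) ℕ.+_) (*-distribˡ-sumℕ (suc k) (x zero) (λ j → S (Fin.toℕ j) x′)) ⟨
  R (suc k) (b ∘ suc) ℕ.+ (b zero ∸ 1) ℕ.* R k (b ∘ suc) ∎
  where
  open ≡-Reasoning
  x : Fin (suc ℓ) → ℕ
  x i = b i ∸ 1
  x′ : Fin ℓ → ℕ
  x′ i = b (suc i) ∸ 1

R-saturated : ∀ ℓ k (b : Fin ℓ → ℕ) → ℓ ≤ k → R (suc k) b ≡ R k b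
R-saturated zero    k       b _         = trans (R-empty (suc k) b) (sym (R-empty k b))
R-saturated (suc ℓ) (suc k) b (s≤s ℓ≤k) = begin
  R (suc (suc k)) b
    ≡⟨ R-suc (suc k) b ⟩
  R (suc (suc k)) (b ∘ suc) ℕ.+ (b zero ∸ 1) ℕ.* R (suc k) (b ∘ suc)
    ≡⟨ cong₂ (λ p q → p ℕ.+ (b zero ∸ 1) ℕ.* q)
             (R-saturated ℓ (suc k) (b ∘ suc) (ℕP.m≤n⇒m≤1+n ℓ≤k)) (R-saturated ℓ k (b ∘ suc) ℓ≤k) ⟩
  R (suc k) (b ∘ suc) ℕ.+ (b zero ∸ 1) ℕ.* R k (b ∘ suc)
    ≡⟨ R-suc k b ⟨
  R (suc k) b ∎
  where open ≡-Reasoning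

gaps-≤ : ∀ {ℓ} {b : Fin ℓ → ℕ} (v : ΔB b) → gaps v ≤ ℓ
gaps-≤ {zero}  v = z≤n
gaps-≤ {suc ℓ} v = ℕP.+-mono-≤ (isGap-≤ (v zero)) (gaps-≤ (v ∘ suc))
  where
  isGap-≤ : ∀ {n} (c : Maybe (Fin n)) → isGap c ≤ 1
  isGap-≤ nothing  = s≤s z≤n
  isGap-≤ (just _) = z≤n

module FirstLetter {ℓ : ℕ} (b : Fin (suc ℓ) → ℕ) where

  infixr 5 _∷ᵥ_

  _∷ᵥ_ : Maybe (Fin (b zero)) → ΔB (b ∘ suc) → ΔB b
  (c ∷ᵥ v) zero    = c
  (c ∷ᵥ v) (suc i) = v i

  gapRow : ∀ {k} → k ≤ ℓ → V ℓ k (b ∘ suc) → V (suc ℓ) k b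
  gapRow k≤ℓ (v , gaps≡) = nothing ∷ᵥ v , trans (cong suc gaps≡) (sym (ℕP.+-∸-assoc 1 k≤ℓ))

  letterRow : ∀ {k} → Fin (b zero) → V ℓ k (b ∘ suc) → V (suc ℓ) (suc k) b
  letterRow y (v , gaps≡) = just y ∷ᵥ v , gaps≡

  A-∷ : ∀ {k k′} (v : V (suc ℓ) k b) (v′ : V ℓ k′ (b ∘ suc)) → (∀ i → proj₁ v (suc i) ≡ proj₁ v′ i) →
        ∀ u → A (suc ℓ) k b v u ≡ 𝟙 (matchCoord? (u zero) (proj₁ v zero)) * A ℓ k′ (b ∘ suc) v′ (tailᵤ u)
  A-∷ v v′ tails u =
    𝟙-× (matchable? u (proj₁ v)) (matchCoord? (u zero) (proj₁ v zero)) (matchable? (tailᵤ u) (proj₁ v′))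
      (λ m → m zero)
      (λ m i x eq → m (suc i) x (trans (tails i) eq))
      (λ m₀ m′ → λ { zero → m₀ ; (suc i) x eq → m′ i x (trans (sym (tails i)) eq) })

  𝟙-matchCoord-just : ∀ (x y : Fin (b zero)) → 𝟙 (matchCoord? x (just y)) ≡ δ x y
  𝟙-matchCoord-just x y = 𝟙-⇔ (matchCoord? x (just y)) (x FinP.≟ y) (λ m → m y refl) (λ { refl _ refl → refl })

  A-gapRow : ∀ {k} (k≤ℓ : k ≤ ℓ) (v′ : V ℓ k (b ∘ suc)) u →
             A (suc ℓ) k b (gapRow {k} k≤ℓ v′) u ≡ 1ℚ * A ℓ k (b ∘ suc) v′ (tailᵤ u)
  A-gapRow {k} k≤ℓ v′ = A-∷ {k} {k} (gapRow {k} k≤ℓ v′) v′ (λ _ → refl)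

  A-letterRow : ∀ {k} y (v′ : V ℓ k (b ∘ suc)) u →
                A (suc ℓ) (suc k) b (letterRow {k} y v′) u ≡ δ (u zero) y * A ℓ k (b ∘ suc) v′ (tailᵤ u)
  A-letterRow {k} y v′ u = trans (A-∷ {suc k} {k} (letterRow {k} y v′) v′ (λ _ → refl) u)
                                 (cong (_* A ℓ k (b ∘ suc) v′ (tailᵤ u)) (𝟙-matchCoord-just (u zero) y))

  data View : (k : ℕ) → V (suc ℓ) k b → Set where
    gap-first    : ∀ {k v} → k ≤ ℓ → (v′ : V ℓ k (b ∘ suc)) →
                   (∀ u → A (suc ℓ) k b v u ≡ A ℓ k (b ∘ suc) v′ (tailᵤ u)) → View k v
    letter-first : ∀ {k v} (y : Fin (b zero)) (v′ : V ℓ k (b ∘ suc)) →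
                   (∀ u → A (suc ℓ) (suc k) b v u ≡ δ (u zero) y * A ℓ k (b ∘ suc) v′ (tailᵤ u)) →
                   View (suc k) v

  view : ∀ {k} (v : V (suc ℓ) k b) → View k v
  view (v , gaps≡) = view-by-first v gaps≡ (v zero) refl
    where
    view-by-first : ∀ {k} (v : ΔB b) (gaps≡ : gaps v ≡ suc ℓ ∸ k) c → v zero ≡ c → View k (v , gaps≡)
    view-by-first {k} v gaps≡ nothing v₀≡ = gap-first k≤ℓ (v ∘ suc , tail-gaps) λ u →
        trans (A-∷ {k} {k} (v , gaps≡) (v ∘ suc , tail-gaps) (λ _ → refl) u)
              (trans (cong (λ c → 𝟙 (matchCoord? (u zero) c) * A′ u) v₀≡) (ℚP.*-identityˡ (A′ u)))
      where
      1+gaps≡ : suc (gaps (v ∘ suc)) ≡ suc ℓ ∸ k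
      1+gaps≡ = subst (λ c → isGap c ℕ.+ gaps (v ∘ suc) ≡ suc ℓ ∸ k) v₀≡ gaps≡
      k≤ℓ : k ≤ ℓ
      k≤ℓ = ℕP.≤-pred (ℕP.m∸n≢0⇒n<m (λ eq → ℕP.1+n≢0 (trans 1+gaps≡ eq)))
      tail-gaps : gaps (v ∘ suc) ≡ ℓ ∸ k
      tail-gaps = ℕP.suc-injective (trans 1+gaps≡ (ℕP.+-∸-assoc 1 k≤ℓ))
      A′ : ΣB b → ℚ
      A′ u = A ℓ k (b ∘ suc) (v ∘ suc , tail-gaps) (tailᵤ u)
    view-by-first {zero} v gaps≡ (just y) v₀≡ = ⊥-elim (ℕP.1+n≰n (subst (_≤ ℓ) tail-gaps (gaps-≤ (v ∘ suc))))
      where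
      tail-gaps : gaps (v ∘ suc) ≡ suc ℓ
      tail-gaps = subst (λ c → isGap c ℕ.+ gaps (v ∘ suc) ≡ suc ℓ) v₀≡ gaps≡
    view-by-first {suc k} v gaps≡ (just y) v₀≡ = letter-first y (v ∘ suc , tail-gaps) λ u →
        trans (A-∷ {suc k} {k} (v , gaps≡) (v ∘ suc , tail-gaps) (λ _ → refl) u)
              (trans (cong (λ c → 𝟙 (matchCoord? (u zero) c) * A′ u) v₀≡)
                     (cong (_* A′ u) (𝟙-matchCoord-just (u zero) y)))
      where
      tail-gaps : gaps (v ∘ suc) ≡ ℓ ∸ k
      tail-gaps = subst (λ c → isGap c ℕ.+ gaps (v ∘ suc) ≡ suc ℓ ∸ suc k) v₀≡ gaps≡
      A′ : ΣB b → ℚ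
      A′ u = A ℓ k (b ∘ suc) (v ∘ suc , tail-gaps) (tailᵤ u)

-- fill the first gap of v with every letter in turn
refine : ∀ {ℓ k} (b : Fin ℓ → ℕ) → k < ℓ → (v : V ℓ k b) → IsSumOfRows (A ℓ (suc k) b) (A ℓ k b v)
refine {suc ℓ} b k<1+ℓ v = by-first k<1+ℓ (view v)
  where
  open FirstLetter b
  by-first : ∀ {k} {v : V (suc ℓ) k b} → k < suc ℓ → View k v →
             IsSumOfRows (A (suc ℓ) (suc k) b) (A (suc ℓ) k b v)
  by-first {k} {v} _ (gap-first _ v′ Av≡) = b zero , (λ t → letterRow {k} t v′) , λ u → begin
    A (suc ℓ) k b v u
      ≡⟨ Av≡ u ⟩
    A ℓ k (b ∘ suc) v′ (tailᵤ u)
      ≡⟨ sumℚ-δ (u zero) (λ _ → A ℓ k (b ∘ suc) v′ (tailᵤ u)) ⟨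
    sumℚ (b zero) (λ t → δ (u zero) t * A ℓ k (b ∘ suc) v′ (tailᵤ u))
      ≡⟨ sumℚ-cong (b zero) (λ t → A-letterRow {k} t v′ u) ⟨
    sumℚ (b zero) (λ t → A (suc ℓ) (suc k) b (letterRow {k} t v′) u) ∎
    where open ≡-Reasoning
  by-first {suc k} {v} (s≤s k<ℓ) (letter-first y v′ Av≡) with refine (b ∘ suc) k<ℓ v′
  ... | N , W , v′≡ΣW = N , (λ t → letterRow {suc k} y (W t)) , λ u → begin
    A (suc ℓ) (suc k) b v u
      ≡⟨ Av≡ u ⟩
    δ (u zero) y * A ℓ k (b ∘ suc) v′ (tailᵤ u)
      ≡⟨ cong (δ (u zero) y *_) (v′≡ΣW (tailᵤ u)) ⟩
    δ (u zero) y * sumℚ N (λ t → A ℓ (suc k) (b ∘ suc) (W t) (tailᵤ u))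
      ≡⟨ *-distribˡ-sumℚ N (δ (u zero) y) _ ⟩
    sumℚ N (λ t → δ (u zero) y * A ℓ (suc k) (b ∘ suc) (W t) (tailᵤ u))
      ≡⟨ sumℚ-cong N (λ t → A-letterRow {suc k} y (W t) u) ⟨
    sumℚ N (λ t → A (suc ℓ) (suc (suc k)) b (letterRow {suc k} y (W t)) u) ∎
    where open ≡-Reasoning

-- Bases of the row space, one more letter at a time

module OneMoreLetter {ℓ : ℕ} (b : Fin (suc ℓ) → ℕ) (1≤b₀ : 1 ≤ b zero) where

  open FirstLetter b

  m : ℕ
  m = b zero ∸ 1

  1+m≡b₀ : suc m ≡ b zero
  1+m≡b₀ = ℕP.m+[n∸m]≡n 1≤b₀

  letter : Fin (suc m) → Fin (b zero)
  letter = Fin.cast 1+m≡b₀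

  letter⁻¹ : Fin (b zero) → Fin (suc m)
  letter⁻¹ = Fin.cast (sym 1+m≡b₀)

  letter-letter⁻¹ : ∀ y → letter (letter⁻¹ y) ≡ y
  letter-letter⁻¹ = FinP.cast-involutive 1+m≡b₀ (sym 1+m≡b₀)

  letter-injective : ∀ {x x′} → letter x ≡ letter x′ → x ≡ x′
  letter-injective {x} {x′} eq = begin
    x                    ≡⟨ FinP.cast-involutive (sym 1+m≡b₀) 1+m≡b₀ x ⟨
    letter⁻¹ (letter x)  ≡⟨ cong letter⁻¹ eq ⟩
    letter⁻¹ (letter x′) ≡⟨ FinP.cast-involutive (sym 1+m≡b₀) 1+m≡b₀ x′ ⟩
    x′                   ∎
    where open ≡-Reasoning

  δ-letter⁻¹ : ∀ y (u : ΣB b) g → δ (u zero) y * g ≡ δ (u zero) (letter (letter⁻¹ y)) * g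
  δ-letter⁻¹ y u g = cong (λ y → δ (u zero) y * g) (sym (letter-letter⁻¹ y))

  letters-partition : ∀ y → sumℚ (suc m) (λ x → δ y (letter x)) ≡ 1ℚ
  letters-partition y = begin
    sumℚ (suc m) (λ x → δ y (letter x))
      ≡⟨ sumℚ-cong (suc m) (λ x → cong (λ z → δ z (letter x)) (sym (letter-letter⁻¹ y))) ⟩
    sumℚ (suc m) (λ x → δ (letter (letter⁻¹ y)) (letter x))
      ≡⟨ sumℚ-cong (suc m) (λ x → trans (δ-injective letter letter-injective (letter⁻¹ y) x)
                                          (sym (ℚP.*-identityʳ (δ (letter⁻¹ y) x)))) ⟩
    sumℚ (suc m) (λ x → δ (letter⁻¹ y) x * 1ℚ)
      ≡⟨ sumℚ-δ (letter⁻¹ y) (λ _ → 1ℚ) ⟩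
    1ℚ ∎
    where open ≡-Reasoning

  first-letter : ∀ y g → δ y (letter zero) * g ≡ g + - 1ℚ * sumℚ m (λ x → δ y (letter (suc x)) * g)
  first-letter y g = begin
    δ₀ * g                         ≡⟨ solve 3 (λ d s g → d :* g := (d :+ s) :* g :+ con (- 1ℚ) :* (s :* g))
                                               refl δ₀ σ g ⟩
    (δ₀ + σ) * g + - 1ℚ * (σ * g)  ≡⟨ cong₂ (λ t s → t * g + - 1ℚ * s)
                                             (letters-partition y) (*-distribʳ-sumℚ m g _) ⟩
    1ℚ * g + - 1ℚ * Σδg            ≡⟨ cong (_+ - 1ℚ * Σδg) (ℚP.*-identityˡ g) ⟩
    g + - 1ℚ * Σδg                 ∎
    where
    open ≡-Reasoning
    δ₀ σ Σδg : ℚ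
    δ₀  = δ y (letter zero)
    σ   = sumℚ m (λ x → δ y (letter (suc x)))
    Σδg = sumℚ m (λ x → δ y (letter (suc x)) * g)

  module _ {k : ℕ} (k≤ℓ : k ≤ ℓ) {n : ℕ} (r : Fin n → V ℓ k (b ∘ suc)) where

    private
      A⁺ : V (suc ℓ) k b → ΣB b → ℚ
      A⁺ = A (suc ℓ) k b
      A⁻ : V ℓ k (b ∘ suc) → ΣB (b ∘ suc) → ℚ
      A⁻ = A ℓ k (b ∘ suc)

    lincomb-gapRows : ∀ c u → lincomb A⁺ c (gapRow k≤ℓ ∘ r) u ≡ lincomb A⁻ c r (tailᵤ u)
    lincomb-gapRows c u = trans
      (lincomb-map {M = A⁺} {M′ = A⁻} (gapRow k≤ℓ) (λ _ → 1ℚ) tailᵤ (A-gapRow k≤ℓ) c r u)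
      (ℚP.*-identityˡ _)

    InSpan-gapRows : ∀ {g} → InSpan A⁻ r g → InSpan A⁺ (gapRow k≤ℓ ∘ r) (g ∘ tailᵤ)
    InSpan-gapRows {g} g∈ =
      InSpan-cong {M = A⁺} {r = gapRow k≤ℓ ∘ r} (λ u → sym (ℚP.*-identityˡ (g (tailᵤ u))))
        (InSpan-map {M = A⁺} {M′ = A⁻} (gapRow k≤ℓ) (λ _ → 1ℚ) tailᵤ (A-gapRow k≤ℓ) {r = r} {g} g∈)

  module _ {k p n : ℕ} (e : Fin p → Fin (b zero)) (r : Fin n → V ℓ k (b ∘ suc)) where

    private
      A⁺ : V (suc ℓ) (suc k) b → ΣB b → ℚ
      A⁺ = A (suc ℓ) (suc k) b
      A⁻ : V ℓ k (b ∘ suc) → ΣB (b ∘ suc) → ℚ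
      A⁻ = A ℓ k (b ∘ suc)

    block : (Fin (p ℕ.* n) → ℚ) → Fin p → Fin n → ℚ
    block c x j = c (combine x j)

    blocks : Fin (p ℕ.* n) → V (suc ℓ) (suc k) b
    blocks i = letterRow {k} (e (proj₁ (remQuot {p} n i))) (r (proj₂ (remQuot {p} n i)))

    blocks-combine : ∀ x j → blocks (combine x j) ≡ letterRow {k} (e x) (r j)
    blocks-combine x j =
      cong (λ xj → letterRow {k} (e (proj₁ xj)) (r (proj₂ xj))) (FinP.remQuot-combine {p} {n} x j)

    lincomb-blocks : ∀ c u → lincomb A⁺ c blocks u ≡
                             sumℚ p (λ x → δ (u zero) (e x) * lincomb A⁻ (block c x) r (tailᵤ u))
    lincomb-blocks c u = trans (sumℚ-combine p n _) (sumℚ-cong p λ x →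
      trans (sumℚ-cong n (λ j → cong (λ v → c (combine x j) * A⁺ v u) (blocks-combine x j)))
            (lincomb-map {M = A⁺} {M′ = A⁻} (letterRow {k} (e x)) (λ u → δ (u zero) (e x)) tailᵤ
                         (A-letterRow {k} (e x)) (block c x) r u))

    lincomb-blocks-at : (∀ {x x′} → e x ≡ e x′ → x ≡ x′) → ∀ c x u′ →
                        lincomb A⁺ c blocks (e x ∷ᵤ u′) ≡ lincomb A⁻ (block c x) r u′
    lincomb-blocks-at e-injective c x u′ = trans (lincomb-blocks c (e x ∷ᵤ u′))
      (trans (sumℚ-cong p (λ x′ → cong (_* L x′) (δ-injective e e-injective x x′))) (sumℚ-δ x L))
      where
      L : Fin p → ℚ
      L x′ = lincomb A⁻ (block c x′) r u′

    lincomb-blocks-outside : ∀ c u → (∀ x → e x ≢ u zero) → lincomb A⁺ c blocks u ≡ 0ℚ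
    lincomb-blocks-outside c u u₀∉e = trans (lincomb-blocks c u) (sumℚ-zeros p λ x →
      trans (cong (_* lincomb A⁻ (block c x) r (tailᵤ u)) (δ-off (u₀∉e x ∘ sym)))
            (ℚP.*-zeroˡ (lincomb A⁻ (block c x) r (tailᵤ u))))

    InSpan-blocks : ∀ x {g} → InSpan A⁻ r g → InSpan A⁺ blocks (λ u → δ (u zero) (e x) * g (tailᵤ u))
    InSpan-blocks x {g} g∈ =
      InSpan-lincomb {M = A⁺} {r = blocks} {r′ = letterRow {k} (e x) ∘ r}
        (λ j → InSpan-row′ {M = A⁺} {r = blocks} (blocks-combine x j))
        (InSpan-map {M = A⁺} {M′ = A⁻} (letterRow {k} (e x)) (λ u → δ (u zero) (e x)) tailᵤ
                    (A-letterRow {k} (e x)) {r = r} {g} g∈)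

  basis-all-gaps : ∀ {n} → Basis (A ℓ 0 (b ∘ suc)) n → Basis (A (suc ℓ) 0 b) n
  basis-all-gaps {n} P = record
    { row         = F
    ; independent = λ c c-rel → P.independent c λ u′ →
        trans (sym (lincomb-gapRows z≤n P.row c (letter zero ∷ᵤ u′))) (c-rel (letter zero ∷ᵤ u′))
    ; spanning    = λ v → span (view v)
    }
    where
    module P = Basis P
    F : Fin n → V (suc ℓ) 0 b
    F = gapRow z≤n ∘ P.row
    span : ∀ {v} → View 0 v → InSpan (A (suc ℓ) 0 b) F (A (suc ℓ) 0 b v)
    span (gap-first _ v′ Av≡) =
      InSpan-cong {M = A (suc ℓ) 0 b} {r = F} Av≡ (InSpan-gapRows z≤n P.row (P.spanning v′))

  basis-some-gaps : ∀ {k n₁ n₂} → k < ℓ → Basis (A ℓ (suc k) (b ∘ suc)) n₁ → Basis (A ℓ k (b ∘ suc)) n₂ →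
                Basis (A (suc ℓ) (suc k) b) (n₁ ℕ.+ m ℕ.* n₂)
  basis-some-gaps {k} {n₁} {n₂} k<ℓ P Q = record { row = F ; independent = F-independent ; spanning = F-spans }
    where
    module P = Basis P
    module Q = Basis Q
    A⁺ : V (suc ℓ) (suc k) b → ΣB b → ℚ
    A⁺ = A (suc ℓ) (suc k) b
    gapPart : Fin n₁ → V (suc ℓ) (suc k) b
    gapPart = gapRow k<ℓ ∘ P.row
    blockPart : Fin (m ℕ.* n₂) → V (suc ℓ) (suc k) b
    blockPart = blocks {k} (letter ∘ suc) Q.row
    F : Fin (n₁ ℕ.+ m ℕ.* n₂) → V (suc ℓ) (suc k) b
    F = gapPart ++ blockPart

    F-independent : LinIndep (A⁺ ∘ F)
    F-independent c c-rel = all-↑ n₁ (m ℕ.* n₂) (P.independent cᴾ gap-zero)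
      (all-combine m n₂ λ x → Q.independent (block {k} (letter ∘ suc) Q.row cᴮ x) (block-zero x))
      where
      cᴾ : Fin n₁ → ℚ
      cᴾ = c ∘ (_↑ˡ m ℕ.* n₂)
      cᴮ : Fin (m ℕ.* n₂) → ℚ
      cᴮ = c ∘ (n₁ ↑ʳ_)
      G : ΣB (b ∘ suc) → ℚ
      G = lincomb (A ℓ (suc k) (b ∘ suc)) cᴾ P.row
      c-rel′ : ∀ u → G (tailᵤ u) + lincomb A⁺ cᴮ blockPart u ≡ 0ℚ
      c-rel′ u = trans (sym (trans (lincomb-++ {M = A⁺} gapPart blockPart c u)
                                   (cong (_+ lincomb A⁺ cᴮ blockPart u) (lincomb-gapRows k<ℓ P.row cᴾ u))))
                       (c-rel u)
      gap-zero : ∀ u′ → G u′ ≡ 0ℚ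
      gap-zero u′ = begin
        G u′                              ≡⟨ ℚP.+-identityʳ (G u′) ⟨
        G u′ + 0ℚ                         ≡⟨ cong (G u′ +_) (lincomb-blocks-outside {k} (letter ∘ suc) Q.row cᴮ u
                                               (λ x eq → FinP.0≢1+n (letter-injective (sym eq)))) ⟨
        G u′ + lincomb A⁺ cᴮ blockPart u  ≡⟨ c-rel′ u ⟩
        0ℚ                                ∎
        where
        open ≡-Reasoning
        u : ΣB b
        u = letter zero ∷ᵤ u′
      block-zero : ∀ x u′ → lincomb (A ℓ k (b ∘ suc)) (block {k} (letter ∘ suc) Q.row cᴮ x) Q.row u′ ≡ 0ℚ
      block-zero x u′ = begin
        L                                 ≡⟨ ℚP.+-identityˡ L ⟨
        0ℚ + L                            ≡⟨ cong₂ _+_ (gap-zero u′)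
                                                 (lincomb-blocks-at {k} (letter ∘ suc) Q.row
                                                    (FinP.suc-injective ∘ letter-injective) cᴮ x u′) ⟨
        G u′ + lincomb A⁺ cᴮ blockPart u  ≡⟨ c-rel′ u ⟩
        0ℚ                                ∎
        where
        open ≡-Reasoning
        u : ΣB b
        u = letter (suc x) ∷ᵤ u′
        L : ℚ
        L = lincomb (A ℓ k (b ∘ suc)) (block {k} (letter ∘ suc) Q.row cᴮ x) Q.row u′

    span-letter : ∀ x {g} → InSpan (A ℓ (suc k) (b ∘ suc)) P.row g → InSpan (A ℓ k (b ∘ suc)) Q.row g →
                  InSpan A⁺ F (λ u → δ (u zero) (letter x) * g (tailᵤ u))
    span-letter (suc x) _ g∈Q =
      InSpan-++ʳ {M = A⁺} gapPart blockPart (InSpan-blocks {k} (letter ∘ suc) Q.row x g∈Q)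
    span-letter zero {g} g∈P g∈Q = InSpan-cong {M = A⁺} {r = F} (λ u → first-letter (u zero) (g (tailᵤ u)))
      (InSpan-+ {M = A⁺} {r = F}
        (InSpan-++ˡ {M = A⁺} gapPart blockPart (InSpan-gapRows k<ℓ P.row g∈P))
        (InSpan-scale {M = A⁺} {r = F} (- 1ℚ)
          (InSpan-sum {M = A⁺} {r = F} m _ (λ x → span-letter (suc x) g∈P g∈Q))))

    F-spans : Spans A⁺ F
    F-spans v = span (view v)
      where
      span : ∀ {v} → View (suc k) v → InSpan A⁺ F (A⁺ v)
      span (gap-first _ v′ Av≡) = InSpan-cong {M = A⁺} {r = F} Av≡
        (InSpan-++ˡ {M = A⁺} gapPart blockPart (InSpan-gapRows k<ℓ P.row (P.spanning v′)))
      span (letter-first y v′ Av≡) = InSpan-cong {M = A⁺} {r = F} (λ u → trans (Av≡ u) (δ-letter⁻¹ y u _))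
        (span-letter (letter⁻¹ y)
          (InSpan-sumOfRows {M = A ℓ (suc k) (b ∘ suc)} {r = P.row} P.spanning (refine (b ∘ suc) k<ℓ v′))
          (Q.spanning v′))

  basis-no-gaps : ∀ {n} → Basis (A ℓ ℓ (b ∘ suc)) n → Basis (A (suc ℓ) (suc ℓ) b) (suc m ℕ.* n)
  basis-no-gaps {n} Q = record
    { row         = F
    ; independent = λ c c-rel → all-combine (suc m) n λ x → Q.independent (block {ℓ} letter Q.row c x) λ u′ →
        trans (sym (lincomb-blocks-at {ℓ} letter Q.row letter-injective c x u′)) (c-rel (letter x ∷ᵤ u′))
    ; spanning    = λ v → span (view v)
    }
    where
    module Q = Basis Q
    A⁺ : V (suc ℓ) (suc ℓ) b → ΣB b → ℚ
    A⁺ = A (suc ℓ) (suc ℓ) b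
    F : Fin (suc m ℕ.* n) → V (suc ℓ) (suc ℓ) b
    F = blocks {ℓ} letter Q.row
    span : ∀ {v} → View (suc ℓ) v → InSpan A⁺ F (A⁺ v)
    span (gap-first 1+ℓ≤ℓ _ _) = ⊥-elim (ℕP.1+n≰n 1+ℓ≤ℓ)
    span (letter-first y v′ Av≡) = InSpan-cong {M = A⁺} {r = F} (λ u → trans (Av≡ u) (δ-letter⁻¹ y u _))
      (InSpan-blocks {ℓ} letter Q.row (letter⁻¹ y) (Q.spanning v′))

basis-empty : (b : Fin 0 → ℕ) → Basis (A 0 0 b) 1
basis-empty b = record
  { row         = λ _ → (λ ()) , refl
  ; independent = λ c c-rel →
      λ { zero → trans (solve 1 (λ x → x := x :* con 1ℚ :+ con 0ℚ) refl (c zero)) (c-rel (λ ())) }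
  ; spanning    = λ v → (λ _ → 1ℚ) , λ u → refl
  }

basis : ∀ ℓ k (b : Fin ℓ → ℕ) → k ≤ ℓ → (∀ i → 1 ≤ b i) → Basis (A ℓ k b) (R k b)
basis zero    zero    b _ _ = subst (Basis (A 0 0 b)) (sym (R-zero b)) (basis-empty b)
basis (suc ℓ) zero    b _ 1≤b = subst (Basis (A (suc ℓ) 0 b)) (trans (R-zero (b ∘ suc)) (sym (R-zero b)))
  (basis-all-gaps (basis ℓ zero (b ∘ suc) z≤n (1≤b ∘ suc)))
  where open OneMoreLetter b (1≤b zero)
basis (suc ℓ) (suc k) b (s≤s k≤ℓ) 1≤b with ℕP.m≤n⇒m<n∨m≡n k≤ℓ
... | inj₁ k<ℓ = subst (Basis (A (suc ℓ) (suc k) b)) (sym (R-suc k b))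
  (basis-some-gaps k<ℓ (basis ℓ (suc k) (b ∘ suc) k<ℓ (1≤b ∘ suc)) (basis ℓ k (b ∘ suc) k≤ℓ (1≤b ∘ suc)))
  where open OneMoreLetter b (1≤b zero)
... | inj₂ refl = subst (Basis (A (suc ℓ) (suc ℓ) b))
  (sym (trans (R-suc ℓ b) (cong (ℕ._+ m ℕ.* R ℓ (b ∘ suc)) (R-saturated ℓ ℓ (b ∘ suc) ℕP.≤-refl))))
  (basis-no-gaps (basis ℓ ℓ (b ∘ suc) ℕP.≤-refl (1≤b ∘ suc)))
  where open OneMoreLetter b (1≤b zero)

A-extensional : ∀ ℓ k b (v : V ℓ k b) → Extensional (A ℓ k b v)
A-extensional ℓ k b (v , _) {u} {u′} u≗u′ = 𝟙-⇔ (matchable? u v) (matchable? u′ v)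
  (λ match i x eq → trans (sym (u≗u′ i)) (match i x eq))
  (λ match i x eq → trans (u≗u′ i) (match i x eq))

corollary1 : (ℓ k : ℕ) (b : Fin ℓ → ℕ) → 1 ≤ ℓ → k ≤ ℓ → (∀ i → 2 ≤ b i) →
    IsRank (AAᵀ ℓ k b) (R k b) × IsRank (A ℓ k b) (R k b)
corollary1 ℓ k b _ k≤ℓ 2≤b = Basis⇒IsRank (Basis-Gram (A ℓ k b) (A-extensional ℓ k b) B) , Basis⇒IsRank B
  where
  B : Basis (A ℓ k b) (R k b)
  B = basis ℓ k b k≤ℓ (λ i → ℕP.≤-trans (s≤s z≤n) (2≤b i))
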